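{- Let $L$ and $R$ be two oriented graphs. If $\operatorname{inv}(L)\geq 1$ and $\operatorname{inv}(R)\geq 1$, then $\operatorname{inv}(L\rightarrow R)\geq 2$.
   Context: An oriented graph is a digraph with no loops, no multiple arcs and no directed cycle of length 2. Inverting a vertex set $X$ means reversing every arc with both ends in $X$. $\operatorname{inv}(D)$ is the minimum number of successive inversions needed to make the oriented graph $D$ acyclic. The dijoin $L\rightarrow R$ is obtained from the disjoint union of $L$ and $R$ by adding all arcs from $V(L)$ to $V(R)$. -}

module Defs where

open import Data.Nat using (ℕ; zero; suc; _+_; _<_)
open import Data.Fin using (Fin; splitAt)
open import Data.Bool using (Bool; true; false; _∧_; if_then_else_)
open import Data.Sum using (inj₁; inj₂)
open import Data.Product using (_×_; Σ; _,_)
open import Data.List using (List; []; _∷_; length; foldl)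
open import Relation.Nullary using (¬_)
open import Relation.Binary.PropositionalEquality using (_≡_)

Digraph : ℕ → Set
Digraph n = Fin n → Fin n → Bool

-- Oriented graph: no loops, no 2-cycles (multiple arcs impossible by construction).
record OrientedGraph (n : ℕ) : Set where
  field
    arc    : Digraph n
    noLoop : ∀ i → arc i i ≡ false
    no2cyc : ∀ i j → ¬ (arc i j ≡ true × arc j i ≡ true)
open OrientedGraph public

VSet : ℕ → Set
VSet n = Fin n → Bool

invert : ∀ {n} → VSet n → Digraph n → Digraph n
invert X a i j = if X i ∧ X j then a j i else a i j

invertAll : ∀ {n} → List (VSet n) → Digraph n → Digraph n
invertAll Xs a = foldl (λ b X → invert X b) a Xs

data Walk {n} (a : Digraph n) : Fin n → Fin n → Set where
  here : ∀ v → Walk a v v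
  step : ∀ {u v w} → a u v ≡ true → Walk a v w → Walk a u w

HasCycle : ∀ {n} → Digraph n → Set
HasCycle {n} a = Σ (Fin n) λ u → Σ (Fin n) λ v → (a u v ≡ true) × Walk a v u

Acyclic : ∀ {n} → Digraph n → Set
Acyclic a = ¬ HasCycle a

InvAtLeast : ℕ → ∀ {n} → OrientedGraph n → Set
InvAtLeast k {n} D = (Xs : List (VSet n)) → length Xs < k → ¬ Acyclic (invertAll Xs (arc D))

-- Dijoin L → R on Fin (m + n): first m vertices are L, last n are R.
dijoinArc : ∀ {m n} → Digraph m → Digraph n → Digraph (m + n)
dijoinArc {m} {n} aL aR i j with splitAt m i | splitAt m j
... | inj₁ x | inj₁ y = aL x y
... | inj₁ x | inj₂ y = true
... | inj₂ x | inj₁ y = false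
... | inj₂ x | inj₂ y = aR x y

dijoin : ∀ {m n} → OrientedGraph m → OrientedGraph n → OrientedGraph (m + n)
dijoin {m} {n} L R = record { arc = dijoinArc (arc L) (arc R) ; noLoop = nl ; no2cyc = n2 }
  where
  nl : ∀ i → dijoinArc (arc L) (arc R) i i ≡ false
  nl i with splitAt m i
  ... | inj₁ x = noLoop L x
  ... | inj₂ x = noLoop R x
  n2 : ∀ i j → ¬ (dijoinArc (arc L) (arc R) i j ≡ true × dijoinArc (arc L) (arc R) j i ≡ true)
  n2 i j with splitAt m i | splitAt m j
  ... | inj₁ x | inj₁ y = no2cyc L x y
  ... | inj₁ x | inj₂ y = λ { (_ , ()) }
  ... | inj₂ x | inj₁ y = λ { (() , _) }
  ... | inj₂ x | inj₂ y = no2cyc R x y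

module Submission where

-- An inversion of X can only destroy a directed cycle C if C leaves X through some arc
-- u → v with u ∈ X, v ∉ X: a cycle inside X is reversed, a cycle outside X is untouched,
-- and a cycle meeting both sides must cross out of X. So if one inversion X made L → R
-- acyclic, the cycles of L and of R would supply an arc u → v of L leaving X and a vertex
-- c of R in X. Then c → u (the inverted arc u → c), u → v and v → c form a cycle.

open import Defs
open import Data.Nat using (_+_; _<_; s≤s; z≤n)
open import Data.Fin using (Fin; _↑ˡ_; _↑ʳ_)
open import Data.Fin.Properties using (splitAt-↑ˡ; splitAt-↑ʳ)
open import Data.Bool using (true; false; _∧_)
open import Data.Sum using (_⊎_; inj₁; inj₂)
open import Data.Product using (_×_; Σ; _,_)
open import Data.List using ([]; _∷_; length)
open import Relation.Binary.PropositionalEquality using (_≡_; refl; sym; trans)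

ArcLeaving : ∀ {n} → Digraph n → VSet n → Set
ArcLeaving {n} a X =
  Σ (Fin n) λ u → Σ (Fin n) λ v → (a u v ≡ true) × (X u ≡ true) × (X v ≡ false)

snoc : ∀ {n} {a : Digraph n} {p q r} → Walk a p q → a q r ≡ true → Walk a p r
snoc (here _)   e′ = step e′ (here _)
snoc (step e w) e′ = step e (snoc w e′)

module _ {n} (a : Digraph n) (X : VSet n) where

  invert-reverses-inside : ∀ i j → X i ≡ true → X j ≡ true → a j i ≡ true → invert X a i j ≡ true
  invert-reverses-inside i j xi xj e rewrite xi | xj = e

  invert-keeps-from-outside : ∀ i j → X i ≡ false → a i j ≡ true → invert X a i j ≡ true
  invert-keeps-from-outside i j xi e rewrite xi = e

  invert-keeps-into-outside : ∀ i j → X j ≡ false → a i j ≡ true → invert X a i j ≡ true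
  invert-keeps-into-outside i j xj e rewrite xj with X i
  ... | true  = e
  ... | false = e

  walk-inside-reverses : ∀ {p q} → Walk a p q → X p ≡ true →
                         ArcLeaving a X ⊎ (X q ≡ true × Walk (invert X a) q p)
  walk-inside-reverses (here _) xp = inj₂ (xp , here _)
  walk-inside-reverses (step {u} {v} e w) xu with X v in xv
  ... | false = inj₁ (u , v , e , xu , xv)
  ... | true with walk-inside-reverses w xv
  ...   | inj₁ out        = inj₁ out
  ...   | inj₂ (xq , w′) = inj₂ (xq , snoc w′ (invert-reverses-inside v u xv xu e))

  walk-exiting-leaves : ∀ {p q} → Walk a p q → X p ≡ true → X q ≡ false → ArcLeaving a X
  walk-exiting-leaves w xp xq with walk-inside-reverses w xp
  ... | inj₁ out       = out
  ... | inj₂ (xq′ , _) with trans (sym xq) xq′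
  ...   | ()

  walk-outside-survives : ∀ {p q} → Walk a p q → X p ≡ false → X q ≡ false →
                          ArcLeaving a X ⊎ Walk (invert X a) p q
  walk-outside-survives (here _) _ _ = inj₂ (here _)
  walk-outside-survives (step {u} {v} e w) xu xq with X v in xv
  ... | true  = inj₁ (walk-exiting-leaves w xv xq)
  ... | false with walk-outside-survives w xv xq
  ...   | inj₁ out = inj₁ out
  ...   | inj₂ w′  = inj₂ (step (invert-keeps-from-outside u v xu e) w′)

  cycle-leaves-or-survives : HasCycle a → ArcLeaving a X ⊎ HasCycle (invert X a)
  cycle-leaves-or-survives (u , v , e , w) with X u in xu | X v in xv
  ... | true  | false = inj₁ (u , v , e , xu , xv)
  ... | false | true  = inj₁ (walk-exiting-leaves w xv xu)
  ... | false | false with walk-outside-survives w xv xu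
  ...   | inj₁ out = inj₁ out
  ...   | inj₂ w′  = inj₂ (u , v , invert-keeps-from-outside u v xu e , w′)
  cycle-leaves-or-survives (u , v , e , w) | true | true with walk-inside-reverses w xv
  ...   | inj₁ out       = inj₁ out
  ...   | inj₂ (_ , w′) = inj₂ (v , u , invert-reverses-inside v u xv xu e , w′)

module Dijoin {m n} (aL : Digraph m) (aR : Digraph n) where

  D : Digraph (m + n)
  D = dijoinArc aL aR

  dijoin-LL : ∀ x y → D (x ↑ˡ n) (y ↑ˡ n) ≡ aL x y
  dijoin-LL x y rewrite splitAt-↑ˡ m x n | splitAt-↑ˡ m y n = refl

  dijoin-RR : ∀ x y → D (m ↑ʳ x) (m ↑ʳ y) ≡ aR x y
  dijoin-RR x y rewrite splitAt-↑ʳ m n x | splitAt-↑ʳ m n y = refl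

  dijoin-LR : ∀ x y → D (x ↑ˡ n) (m ↑ʳ y) ≡ true
  dijoin-LR x y rewrite splitAt-↑ˡ m x n | splitAt-↑ʳ m n y = refl

  module _ (X : VSet (m + n)) where

    XL : VSet m
    XL i = X (i ↑ˡ n)

    XR : VSet n
    XR i = X (m ↑ʳ i)

    invert-LL : ∀ i j → invert X D (i ↑ˡ n) (j ↑ˡ n) ≡ invert XL aL i j
    invert-LL i j with X (i ↑ˡ n) ∧ X (j ↑ˡ n)
    ... | true  = dijoin-LL j i
    ... | false = dijoin-LL i j

    invert-RR : ∀ i j → invert X D (m ↑ʳ i) (m ↑ʳ j) ≡ invert XR aR i j
    invert-RR i j with X (m ↑ʳ i) ∧ X (m ↑ʳ j)
    ... | true  = dijoin-RR j i
    ... | false = dijoin-RR i j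

    embedL : ∀ {p q} → Walk (invert XL aL) p q → Walk (invert X D) (p ↑ˡ n) (q ↑ˡ n)
    embedL (here _)           = here _
    embedL (step {u} {v} e w) = step (trans (invert-LL u v) e) (embedL w)

    embedR : ∀ {p q} → Walk (invert XR aR) p q → Walk (invert X D) (m ↑ʳ p) (m ↑ʳ q)
    embedR (here _)           = here _
    embedR (step {u} {v} e w) = step (trans (invert-RR u v) e) (embedR w)

    embedL-cycle : HasCycle (invert XL aL) → HasCycle (invert X D)
    embedL-cycle (u , v , e , w) = u ↑ˡ n , v ↑ˡ n , trans (invert-LL u v) e , embedL w

    embedR-cycle : HasCycle (invert XR aR) → HasCycle (invert X D)
    embedR-cycle (u , v , e , w) = m ↑ʳ u , m ↑ʳ v , trans (invert-RR u v) e , embedR w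

    triangle : ∀ {u v c} → aL u v ≡ true → XL u ≡ true → XL v ≡ false → XR c ≡ true →
               HasCycle (invert X D)
    triangle {u} {v} {c} e xu xv xc =
      m ↑ʳ c , u ↑ˡ n ,
      invert-reverses-inside D X (m ↑ʳ c) (u ↑ˡ n) xc xu (dijoin-LR u c) ,
      step (invert-keeps-into-outside D X (u ↑ˡ n) (v ↑ˡ n) xv (trans (dijoin-LL u v) e))
        (step (invert-keeps-from-outside D X (v ↑ˡ n) (m ↑ʳ c) xv (dijoin-LR v c)) (here _))

    invert-dijoin-hasCycle : HasCycle aL → HasCycle aR → HasCycle (invert X D)
    invert-dijoin-hasCycle cL cR
      with cycle-leaves-or-survives aL XL cL | cycle-leaves-or-survives aR XR cR
    ... | inj₂ cL′                   | _                         = embedL-cycle cL′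
    ... | inj₁ _                     | inj₂ cR′                  = embedR-cycle cR′
    ... | inj₁ (_ , _ , e , xu , xv) | inj₁ (_ , _ , _ , xc , _) = triangle e xu xv xc

proposition3p1 : ∀ {m n} (L : OrientedGraph m) (R : OrientedGraph n) →
    InvAtLeast 1 L → InvAtLeast 1 R → InvAtLeast 2 (dijoin L R)
proposition3p1 L R hL hR Xs len acyclic =
  hL [] (s≤s z≤n) λ cL → hR [] (s≤s z≤n) λ cR → acyclic (cyclic Xs len cL cR)
  where
  open Dijoin (arc L) (arc R)
  cyclic : ∀ Xs → length Xs < 2 → HasCycle (arc L) → HasCycle (arc R) →
           HasCycle (invertAll Xs D)
  -- Inverting the empty set is definitionally the identity.
  cyclic []       _ = invert-dijoin-hasCycle (λ _ → false)
  cyclic (X ∷ []) _ = invert-dijoin-hasCycle X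
  cyclic (_ ∷ _ ∷ _) (s≤s (s≤s ()))
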